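{- For all integers $n\ge 0$, $C_n+3M_n\le M_{n+2}$, where $C_n$ is the number of noncrossing partitions of $[n]$.
   Context: For $n\ge 0$, $[n]=\{1,\dots,n\}$ (with $[0]=\emptyset$, whose unique partition is the empty partition, which is noncrossing). A partition $\pi$ of $[n]$ is noncrossing if there are no two distinct blocks $A,B$ of $\pi$ and elements $a<b$ in $A$, $c<d$ in $B$ with $a<c<b<d$. A noncrossing partition $\pi$ of $[n]$ is a marriageable singles partition if it has two distinct singleton blocks $\{i\},\{j\}$ ($i\ne j$) such that the partition obtained by replacing these two blocks with the block $\{i,j\}$ is still noncrossing. $M_n$ denotes the number of marriageable singles partitions of $[n]$. -}

module Defs where

open import Data.Nat using (ℕ; zero; suc; _+_)
open import Data.Bool using (Bool; true; false; _∧_; _∨_; not; if_then_else_)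
open import Data.Fin using (Fin; _<?_; _≤?_; _≟_)
open import Data.List using (List; []; _∷_; concatMap; map; allFin)
open import Data.Bool.ListAction using (all; any)
open import Data.Vec using (Vec; []; _∷_; lookup)
open import Relation.Nullary.Decidable using (⌊_⌋)

-- Elements of [n] are represented by Fin n (i.e. 0..n-1, order-preserving shift).
-- A set partition of [n] is represented canonically by the map f : Fin n → Fin n
-- sending each element to the least element of its block.  Such maps are
-- exactly the vectors f with  f i ≤ i  and  f (f i) = f i  for all i.

allVecs : (n k : ℕ) → List (Vec (Fin k) n)
allVecs zero    k = [] ∷ []
allVecs (suc n) k = concatMap (λ x → map (x ∷_) (allVecs n k)) (allFin k)

count : {A : Set} → (A → Bool) → List A → ℕ
count p []       = 0
count p (x ∷ xs) = if p x then suc (count p xs) else count p xs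

module _ {n : ℕ} where

  ∀[_] : (Fin n → Bool) → Bool
  ∀[ p ] = all p (allFin n)

  ∃[_] : (Fin n → Bool) → Bool
  ∃[ p ] = any p (allFin n)

  _==_ : Fin n → Fin n → Bool
  x == y = ⌊ x ≟ y ⌋

  _<ᵇ_ : Fin n → Fin n → Bool
  x <ᵇ y = ⌊ x <? y ⌋

  isPartition : Vec (Fin n) n → Bool
  isPartition f = ∀[ (λ i → ⌊ lookup f i ≤? i ⌋ ∧ (lookup f (lookup f i) == lookup f i)) ]

  sameBlock : Vec (Fin n) n → Fin n → Fin n → Bool
  sameBlock f x y = lookup f x == lookup f y

  noncrossingRel : (Fin n → Fin n → Bool) → Bool
  noncrossingRel R = not ∃[ (λ a → ∃[ (λ c → ∃[ (λ b → ∃[ (λ d →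
      (a <ᵇ c) ∧ (c <ᵇ b) ∧ (b <ᵇ d) ∧ R a b ∧ R c d ∧ not (R a c)) ]) ]) ]) ]

  isNoncrossing : Vec (Fin n) n → Bool
  isNoncrossing f = isPartition f ∧ noncrossingRel (sameBlock f)

  isSingleton : Vec (Fin n) n → Fin n → Bool
  isSingleton f i = ∀[ (λ j → not (sameBlock f i j) ∨ (j == i)) ]

  mergedBlock : Vec (Fin n) n → Fin n → Fin n → Fin n → Fin n → Bool
  mergedBlock f i j x y = sameBlock f x y ∨ ((x == i) ∧ (y == j)) ∨ ((x == j) ∧ (y == i))

  isMarriageable : Vec (Fin n) n → Bool
  isMarriageable f = isNoncrossing f ∧ ∃[ (λ i → ∃[ (λ j →
      not (i == j) ∧ isSingleton f i ∧ isSingleton f j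
      ∧ noncrossingRel (mergedBlock f i j)) ]) ]

C : ℕ → ℕ
C n = count isNoncrossing (allVecs n n)

M : ℕ → ℕ
M n = count isMarriageable (allVecs n n)

-- Four maps send partitions of [n] (n ≥ 1) to marriageable singles partitions of [n+2]:
--   a noncrossing π   ↦ {1} ∪ (π + 1) ∪ {n+2}, whose end singletons marry;
--   a marriageable π  ↦ {1, n+2} ∪ (π + 1);
--   a marriageable π  ↦ {1, 2} ∪ (π + 2);
--   a marriageable π  ↦ {1} ∪ (π + 1) with n+2 added to the block of n+1.
-- Each keeps the married couple of π, except the last one when {n} is married to {o}:
-- then n+1 is no longer single and o+1 marries 1 instead, which is noncrossing because
-- (as {o} and {n} can marry) no block of π has elements on both sides of o.
-- The maps are injective with pairwise disjoint images: the block of n+2 is a singleton,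
-- contains 1, or contains n+1, and only the third map puts 1 and 2 together.
-- The case n = 0 is checked by evaluation.
module Submission where

open import Defs
open import Data.Bool using (Bool; true; false; T; not; _∧_; _∨_)
open import Data.Bool.Properties using (T-∧; T-∨; T?)
open import Data.Empty using (⊥-elim)
open import Data.Fin as Fin using (Fin; zero; suc; toℕ; inject₁; fromℕ; _≟_)
import Data.Fin.Properties as Fin
open import Data.List using (List; []; _∷_; _++_; allFin; length; map; concat; concatMap; cartesianProductWith; filterᵇ)
open import Data.List.Properties using (length-++; length-map)
open import Data.List.Membership.Propositional using (_∈_; lose)
open import Data.List.Membership.Propositional.Properties
  using (∈-allFin; ∈-∃++; ∈-++⁻; ∈-++⁺ˡ; ∈-++⁺ʳ; ∈-filter⁺; ∈-cartesianProductWith⁺; ∈-map⁻)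
open import Data.List.Relation.Binary.Disjoint.Propositional using (Disjoint)
open import Data.List.Relation.Binary.Subset.Propositional using (_⊆_)
open import Data.List.Relation.Unary.All as All using (All; []; _∷_)
import Data.List.Relation.Unary.All.Properties as All
open import Data.List.Relation.Unary.AllPairs using (AllPairs; []; _∷_)
open import Data.List.Relation.Unary.Any using (here; there; satisfied)
open import Data.List.Relation.Unary.Any.Properties using (any⁺; any⁻)
open import Data.List.Relation.Unary.Unique.Propositional using (Unique)
import Data.List.Relation.Unary.Unique.Propositional.Properties as Unique
open import Data.Nat using (ℕ; zero; suc; _+_; _*_; _≤_; z≤n; s≤s)
import Data.Nat as ℕ
import Data.Nat.Properties as ℕ
open import Data.Nat.ListAction using (sum)
open import Data.Product using (∃; _×_; _,_; proj₁; proj₂)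
open import Data.Product.Function.NonDependent.Propositional using (_×-⇔_)
open import Data.Sum using (_⊎_; inj₁; inj₂; [_,_])
open import Data.Sum.Function.Propositional using (_⊎-⇔_)
open import Data.Unit using (⊤)
open import Data.Vec using (Vec; []; _∷_; _∷ʳ_; lookup)
import Data.Vec as Vec
import Data.Vec.Properties as Vec
open import Function using (_∘_)
open import Function.Bundles using (_⇔_; mk⇔; Equivalence)
open import Function.Construct.Composition using (_⇔-∘_)
import Function.Properties.Equivalence as ⇔
open import Relation.Binary.Definitions using (tri<; tri≈; tri>)
open import Relation.Binary.PropositionalEquality
  using (_≡_; _≢_; refl; sym; trans; cong; cong₂; subst; subst₂; module ≡-Reasoning)
open import Relation.Nullary using (¬_; Dec; yes; no; contradiction)
open import Relation.Nullary.Decidable using (⌊_⌋; toWitness; fromWitness; decidable-stable)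

open Equivalence using (to; from)
open ≡-Reasoning

module _ {n : ℕ} where

  SameBlock : Vec (Fin n) n → Fin n → Fin n → Set
  SameBlock f x y = lookup f x ≡ lookup f y

  IsPartition : Vec (Fin n) n → Set
  IsPartition f = ∀ i → lookup f i Fin.≤ i × lookup f (lookup f i) ≡ lookup f i

  Noncrossing : (Fin n → Fin n → Set) → Set
  Noncrossing R = ∀ a c b d → a Fin.< c → c Fin.< b → b Fin.< d → R a b → R c d → R a c

  NoncrossingPartition : Vec (Fin n) n → Set
  NoncrossingPartition f = IsPartition f × Noncrossing (SameBlock f)

  IsSingleton : Vec (Fin n) n → Fin n → Set
  IsSingleton f i = ∀ j → SameBlock f i j → j ≡ i

  Merge : (Fin n → Fin n → Set) → Fin n → Fin n → Fin n → Fin n → Set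
  Merge R i j x y = R x y ⊎ (x ≡ i × y ≡ j) ⊎ (x ≡ j × y ≡ i)

  record Marriage (f : Vec (Fin n) n) : Set where
    constructor marriage
    field
      i j               : Fin n
      i≢j               : i ≢ j
      i-single          : IsSingleton f i
      j-single          : IsSingleton f j
      noncrossing-merge : Noncrossing (Merge (SameBlock f) i j)

  Marriageable : Vec (Fin n) n → Set
  Marriageable f = NoncrossingPartition f × Marriage f

module _ {n : ℕ} {R : Fin n → Fin n → Set} where

  Noncrossing-cong : {Q : Fin n → Fin n → Set} → (∀ {x y} → R x y ⇔ Q x y) → Noncrossing R ⇔ Noncrossing Q
  Noncrossing-cong R⇔Q = mk⇔
    (λ nc a c b d a<c c<b b<d Qab Qcd → to R⇔Q (nc a c b d a<c c<b b<d (from R⇔Q Qab) (from R⇔Q Qcd)))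
    (λ nc a c b d a<c c<b b<d Rab Rcd → from R⇔Q (nc a c b d a<c c<b b<d (to R⇔Q Rab) (to R⇔Q Rcd)))

  Merge-cong : {Q : Fin n → Fin n → Set} {i j : Fin n} →
               (∀ {x y} → R x y ⇔ Q x y) → ∀ {x y} → Merge R i j x y ⇔ Merge Q i j x y
  Merge-cong R⇔Q = R⇔Q ⊎-⇔ ⇔.refl

  Merge-comm : {i j : Fin n} → ∀ {x y} → Merge R i j x y ⇔ Merge R j i x y
  Merge-comm = mk⇔ swap′ swap′
    where
    swap′ : ∀ {i j x y} → Merge R i j x y → Merge R j i x y
    swap′ (inj₁ r)        = inj₁ r
    swap′ (inj₂ (inj₁ e)) = inj₂ (inj₂ e)
    swap′ (inj₂ (inj₂ e)) = inj₂ (inj₁ e)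

  StaysBetween : Fin n → Fin n → Set
  StaysBetween p q = ∀ {x y} → p Fin.< x → x Fin.< q → R x y → p Fin.< y × y Fin.< q

  Noncrossing-Merge : {p q : Fin n} → (∀ {x y} → R x y → R y x) → Noncrossing R → p Fin.< q →
                      StaysBetween p q → Noncrossing (Merge R p q)
  Noncrossing-Merge R-sym nc p<q stays a c b d a<c c<b b<d (inj₁ Rab) (inj₁ Rcd) =
    inj₁ (nc a c b d a<c c<b b<d Rab Rcd)
  Noncrossing-Merge R-sym nc p<q stays a c b d a<c c<b b<d (inj₁ Rab) (inj₂ (inj₁ (refl , refl))) =
    ⊥-elim (Fin.<-asym a<c (proj₁ (stays c<b b<d (R-sym Rab))))
  Noncrossing-Merge R-sym nc p<q stays a c b d a<c c<b b<d (inj₁ Rab) (inj₂ (inj₂ (refl , refl))) =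
    ⊥-elim (Fin.<-asym p<q (Fin.<-trans c<b b<d))
  Noncrossing-Merge R-sym nc p<q stays a c b d a<c c<b b<d (inj₂ (inj₁ (refl , refl))) (inj₁ Rcd) =
    ⊥-elim (Fin.<-asym b<d (proj₂ (stays a<c c<b Rcd)))
  Noncrossing-Merge R-sym nc p<q stays a c b d a<c c<b b<d (inj₂ (inj₁ (refl , refl))) (inj₂ (inj₁ (refl , _))) =
    ⊥-elim (Fin.<-irrefl refl a<c)
  Noncrossing-Merge R-sym nc p<q stays a c b d a<c c<b b<d (inj₂ (inj₁ (refl , refl))) (inj₂ (inj₂ (refl , _))) =
    ⊥-elim (Fin.<-irrefl refl c<b)
  Noncrossing-Merge R-sym nc p<q stays a c b d a<c c<b b<d (inj₂ (inj₂ (refl , refl))) _ =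
    ⊥-elim (Fin.<-asym p<q (Fin.<-trans a<c c<b))

T-⌊⌋ : {A : Set} {a? : Dec A} → T ⌊ a? ⌋ ⇔ A
T-⌊⌋ = mk⇔ toWitness fromWitness

T-not : {b : Bool} → T (not b) ⇔ (¬ T b)
T-not {false} = mk⇔ (λ _ ()) _
T-not {true}  = mk⇔ (λ ()) (λ ¬t → ¬t _)

T-∧-⇔ : {x y : Bool} {A B : Set} → T x ⇔ A → T y ⇔ B → T (x ∧ y) ⇔ (A × B)
T-∧-⇔ p q = (p ×-⇔ q) ⇔-∘ T-∧

T-∨-⇔ : {x y : Bool} {A B : Set} → T x ⇔ A → T y ⇔ B → T (x ∨ y) ⇔ (A ⊎ B)
T-∨-⇔ p q = (p ⊎-⇔ q) ⇔-∘ T-∨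

module _ {n : ℕ} where

  T-== : {x y : Fin n} → T (x == y) ⇔ x ≡ y
  T-== {x} {y} = T-⌊⌋ {a? = x ≟ y}

  T-<ᵇ : {x y : Fin n} → T (x <ᵇ y) ⇔ x Fin.< y
  T-<ᵇ {x} {y} = T-⌊⌋ {a? = x Fin.<? y}

  T-∀ : {p : Fin n → Bool} → T ∀[ p ] ⇔ (∀ x → T (p x))
  T-∀ {p} = mk⇔ (λ t x → All.lookup (All.all⁺ p (allFin n) t) (∈-allFin x))
                (λ h → All.all⁻ p {xs = allFin n} (All.tabulate (λ {x} _ → h x)))

  T-∃ : {p : Fin n → Bool} → T ∃[ p ] ⇔ ∃ (T ∘ p)
  T-∃ {p} = mk⇔ (satisfied ∘ any⁻ p (allFin n)) (λ (x , px) → any⁺ p (lose (∈-allFin x) px))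

  T-noncrossingRel : (R : Fin n → Fin n → Bool) → T (noncrossingRel R) ⇔ Noncrossing (λ x y → T (R x y))
  T-noncrossingRel R = mk⇔ noncrossing crossing-free
    where
    T-crossing : ∀ {a c b d} →
      T ((a <ᵇ c) ∧ (c <ᵇ b) ∧ (b <ᵇ d) ∧ R a b ∧ R c d ∧ not (R a c)) ⇔
      (a Fin.< c × c Fin.< b × b Fin.< d × T (R a b) × T (R c d) × ¬ T (R a c))
    T-crossing = T-∧-⇔ T-<ᵇ (T-∧-⇔ T-<ᵇ (T-∧-⇔ T-<ᵇ (T-∧-⇔ ⇔.refl (T-∧-⇔ ⇔.refl T-not))))

    noncrossing : T (noncrossingRel R) → Noncrossing (λ x y → T (R x y))
    noncrossing t a c b d a<c c<b b<d Rab Rcd = decidable-stable (T? (R a c)) λ ¬Rac →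
      to T-not t (from T-∃ (a , from T-∃ (c , from T-∃ (b , from T-∃ (d ,
        from T-crossing (a<c , c<b , b<d , Rab , Rcd , ¬Rac))))))

    crossing-free : Noncrossing (λ x y → T (R x y)) → T (noncrossingRel R)
    crossing-free nc = from T-not λ t →
      let a , t = to T-∃ t ; c , t = to T-∃ t ; b , t = to T-∃ t ; d , t = to T-∃ t
          a<c , c<b , b<d , Rab , Rcd , ¬Rac = to T-crossing t
      in ¬Rac (nc a c b d a<c c<b b<d Rab Rcd)

  T-isNoncrossing : {f : Vec (Fin n) n} → T (isNoncrossing f) ⇔ NoncrossingPartition f
  T-isNoncrossing {f} = T-∧-⇔ isPartition⇔ (Noncrossing-cong T-== ⇔-∘ T-noncrossingRel (sameBlock f))
    where
    isPartition⇔ : T (isPartition f) ⇔ IsPartition f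
    isPartition⇔ = mk⇔ (λ t i → to (pointwise i) (to T-∀ t i))
                       (λ h → from T-∀ (λ i → from (pointwise i) (h i)))
      where
      pointwise : ∀ i → T (⌊ lookup f i Fin.≤? i ⌋ ∧ (lookup f (lookup f i) == lookup f i)) ⇔
                        (lookup f i Fin.≤ i × lookup f (lookup f i) ≡ lookup f i)
      pointwise i = T-∧-⇔ (T-⌊⌋ {a? = lookup f i Fin.≤? i}) T-==

  T-isSingleton : {f : Vec (Fin n) n} {i : Fin n} → T (isSingleton f i) ⇔ IsSingleton f i
  T-isSingleton {f} {i} = mk⇔
    (λ t j same → [ (λ apart → contradiction (from T-== same) apart) , (λ j≡i → j≡i) ]
                    (to (T-∨-⇔ T-not T-==) (to T-∀ t j)))
    (λ single → from T-∀ λ j → from (T-∨-⇔ T-not T-==) (decide j (single j)))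
    where
    decide : ∀ j → (SameBlock f i j → j ≡ i) → ¬ T (sameBlock f i j) ⊎ j ≡ i
    decide j single with T? (sameBlock f i j)
    ... | yes same = inj₂ (single (to T-== same))
    ... | no apart = inj₁ apart

  T-isMarriageable : {f : Vec (Fin n) n} → T (isMarriageable f) ⇔ Marriageable f
  T-isMarriageable {f} = T-∧-⇔ (T-isNoncrossing {f}) (mk⇔ married proposal)
    where
    T-mergedBlock : ∀ {i j x y} → T (mergedBlock f i j x y) ⇔ Merge (SameBlock f) i j x y
    T-mergedBlock = T-∨-⇔ T-== (T-∨-⇔ (T-∧-⇔ T-== T-==) (T-∧-⇔ T-== T-==))

    couple : Fin n → Fin n → Bool
    couple i j = not (i == j) ∧ isSingleton f i ∧ isSingleton f j ∧ noncrossingRel (mergedBlock f i j)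

    T-couple : ∀ {i j} → T (couple i j) ⇔
      (¬ T (i == j) × IsSingleton f i × IsSingleton f j × Noncrossing (Merge (SameBlock f) i j))
    T-couple {i} {j} = T-∧-⇔ T-not (T-∧-⇔ (T-isSingleton {f}) (T-∧-⇔ (T-isSingleton {f})
      (Noncrossing-cong T-mergedBlock ⇔-∘ T-noncrossingRel (mergedBlock f i j))))

    married : T ∃[ (λ i → ∃[ couple i ]) ] → Marriage f
    married t =
      let i , t = to T-∃ t ; j , t = to T-∃ t
          i≉j , i-single , j-single , nc = to T-couple t
      in marriage i j (i≉j ∘ from T-==) i-single j-single nc

    proposal : Marriage f → T ∃[ (λ i → ∃[ couple i ]) ]
    proposal (marriage i j i≢j i-single j-single nc) =
      from T-∃ (i , from T-∃ (j , from T-couple (i≢j ∘ to T-== , i-single , j-single , nc)))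

module _ {A : Set} where

  count≡length-filterᵇ : (p : A → Bool) (xs : List A) → count p xs ≡ length (filterᵇ p xs)
  count≡length-filterᵇ p []       = refl
  count≡length-filterᵇ p (x ∷ xs) with p x
  ... | true  = cong suc (count≡length-filterᵇ p xs)
  ... | false = count≡length-filterᵇ p xs

  ∈-++-∷⁻ : (ys₁ : List A) {ys₂ : List A} {x y : A} →
            y ≢ x → y ∈ ys₁ ++ x ∷ ys₂ → y ∈ ys₁ ++ ys₂
  ∈-++-∷⁻ ys₁ y≢x y∈ys with ∈-++⁻ ys₁ y∈ys
  ... | inj₁ y∈ys₁          = ∈-++⁺ˡ y∈ys₁
  ... | inj₂ (here refl)    = contradiction refl y≢x
  ... | inj₂ (there y∈ys₂)  = ∈-++⁺ʳ ys₁ y∈ys₂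

  length-++-∷ : (ys₁ : List A) {ys₂ : List A} {x : A} →
                length (ys₁ ++ x ∷ ys₂) ≡ suc (length (ys₁ ++ ys₂))
  length-++-∷ ys₁ {ys₂} = begin
    length (ys₁ ++ _ ∷ ys₂)          ≡⟨ length-++ ys₁ ⟩
    length ys₁ + suc (length ys₂)    ≡⟨ ℕ.+-suc (length ys₁) (length ys₂) ⟩
    suc (length ys₁ + length ys₂)    ≡⟨ cong suc (length-++ ys₁) ⟨
    suc (length (ys₁ ++ ys₂))        ∎

  Unique-⊆⇒length≤ : {xs ys : List A} → Unique xs → xs ⊆ ys → length xs ≤ length ys
  Unique-⊆⇒length≤ []                _  = z≤n
  Unique-⊆⇒length≤ {x ∷ xs} (x∉xs ∷ u) xs⊆ys with ∈-∃++ (xs⊆ys (here refl))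
  ... | ys₁ , ys₂ , refl = subst (suc (length xs) ≤_) (sym (length-++-∷ ys₁))
    (s≤s (Unique-⊆⇒length≤ u λ y∈xs →
      ∈-++-∷⁻ ys₁ (λ y≡x → All.lookup x∉xs y∈xs (sym y≡x)) (xs⊆ys (there y∈xs))))

  Unique-⊆⇒length≤count : (p : A → Bool) {xs ys : List A} → Unique xs → xs ⊆ ys → All (T ∘ p) xs →
                          length xs ≤ count p ys
  Unique-⊆⇒length≤count p {ys = ys} u xs⊆ys pxs = subst (_ ≤_) (sym (count≡length-filterᵇ p ys))
    (Unique-⊆⇒length≤ u λ x∈xs → ∈-filter⁺ (T? ∘ p) (xs⊆ys x∈xs) (All.lookup pxs x∈xs))

concatMap≡cartesianProductWith : {A B C : Set} (g : A → B → C) (xs : List A) (ys : List B) →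
                                 concatMap (λ x → map (g x) ys) xs ≡ cartesianProductWith g xs ys
concatMap≡cartesianProductWith g []       ys = refl
concatMap≡cartesianProductWith g (x ∷ xs) ys = cong (map (g x) ys ++_) (concatMap≡cartesianProductWith g xs ys)

∈-allVecs : {n k : ℕ} (v : Vec (Fin k) n) → v ∈ allVecs n k
∈-allVecs []                = here refl
∈-allVecs {suc n} {k} (x ∷ v) = subst (_ ∈_) (sym (concatMap≡cartesianProductWith _∷_ (allFin k) (allVecs n k)))
  (∈-cartesianProductWith⁺ _∷_ (∈-allFin x) (∈-allVecs v))

allVecs-unique : (n k : ℕ) → Unique (allVecs n k)
allVecs-unique zero    k = [] ∷ []
allVecs-unique (suc n) k = subst Unique (sym (concatMap≡cartesianProductWith _∷_ (allFin k) (allVecs n k)))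
  (Unique.cartesianProductWith⁺ _∷_ Vec.∷-injective (Unique.allFin⁺ k) (allVecs-unique n k))

lookup-∷ʳ-inject₁ : {A : Set} {n : ℕ} (xs : Vec A n) (y : A) (i : Fin n) →
                    lookup (xs ∷ʳ y) (inject₁ i) ≡ lookup xs i
lookup-∷ʳ-inject₁ (x ∷ xs) y zero    = refl
lookup-∷ʳ-inject₁ (x ∷ xs) y (suc i) = lookup-∷ʳ-inject₁ xs y i

lookup-∷ʳ-fromℕ : {A : Set} {n : ℕ} (xs : Vec A n) (y : A) → lookup (xs ∷ʳ y) (fromℕ n) ≡ y
lookup-∷ʳ-fromℕ []       y = refl
lookup-∷ʳ-fromℕ (x ∷ xs) y = lookup-∷ʳ-fromℕ xs y

data Inject₁OrFromℕ {n : ℕ} : Fin (suc n) → Set where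
  is-inject₁ : (i : Fin n) → Inject₁OrFromℕ (inject₁ i)
  is-fromℕ   : Inject₁OrFromℕ (fromℕ n)

inject₁-or-fromℕ : {n : ℕ} (i : Fin (suc n)) → Inject₁OrFromℕ i
inject₁-or-fromℕ {zero}  zero    = is-fromℕ
inject₁-or-fromℕ {suc n} zero    = is-inject₁ zero
inject₁-or-fromℕ {suc n} (suc i) with inject₁-or-fromℕ i
... | is-inject₁ j = is-inject₁ (suc j)
... | is-fromℕ     = is-fromℕ

map-injective : {A B : Set} {n : ℕ} {g : A → B} → (∀ {x y} → g x ≡ g y → x ≡ y) →
                {xs ys : Vec A n} → Vec.map g xs ≡ Vec.map g ys → xs ≡ ys
map-injective g-inj {[]}     {[]}     _ = refl
map-injective g-inj {x ∷ xs} {y ∷ ys} e = let x≡y , xs≡ys = Vec.∷-injective e in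
  cong₂ _∷_ (g-inj x≡y) (map-injective g-inj xs≡ys)

module Enclose {N : ℕ} where

  start end : Fin (2 + N)
  start = zero
  end   = fromℕ (suc N)

  shift : Fin N → Fin (2 + N)
  shift = suc ∘ inject₁

  data Position : Fin (2 + N) → Set where
    is-start : Position start
    is-shift : (x : Fin N) → Position (shift x)
    is-end   : Position end

  position : (x : Fin (2 + N)) → Position x
  position zero    = is-start
  position (suc y) with inject₁-or-fromℕ y
  ... | is-inject₁ x = is-shift x
  ... | is-fromℕ     = is-end

  shift-injective : {x y : Fin N} → shift x ≡ shift y → x ≡ y
  shift-injective = Fin.inject₁-injective ∘ Fin.suc-injective

  shift≢end : {x : Fin N} → shift x ≢ end
  shift≢end = Fin.fromℕ≢inject₁ ∘ sym ∘ Fin.suc-injective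

  toℕ-shift : (x : Fin N) → toℕ (shift x) ≡ suc (toℕ x)
  toℕ-shift x = cong suc (Fin.toℕ-inject₁ x)

  shift-cancel-< : {x y : Fin N} → shift x Fin.< shift y → x Fin.< y
  shift-cancel-< {x} {y} = ℕ.s<s⁻¹ ∘ subst₂ ℕ._<_ (toℕ-shift x) (toℕ-shift y)

  shift-mono-≤ : {x y : Fin N} → x Fin.≤ y → shift x Fin.≤ shift y
  shift-mono-≤ {x} {y} = subst₂ ℕ._≤_ (sym (toℕ-shift x)) (sym (toℕ-shift y)) ∘ s≤s

  shift-mono-< : {x y : Fin N} → x Fin.< y → shift x Fin.< shift y
  shift-mono-< {x} {y} = subst₂ ℕ._<_ (sym (toℕ-shift x)) (sym (toℕ-shift y)) ∘ s≤s

  end-maximal : (x : Fin (2 + N)) → ¬ (end Fin.< x)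
  end-maximal x end<x = ℕ.<⇒≱ end<x (Fin.≤fromℕ x)

  -- The partition {1} ∪ (f + 1) ∪ {N+2} of [N+2], except that N+2 joins the block with least element c.
  enclose : Fin (2 + N) → Vec (Fin N) N → Vec (Fin (2 + N)) (2 + N)
  enclose c f = start ∷ (Vec.map shift f ∷ʳ c)

  module _ (c : Fin (2 + N)) (f : Vec (Fin N) N) where

    lookup-enclose-shift : (x : Fin N) → lookup (enclose c f) (shift x) ≡ shift (lookup f x)
    lookup-enclose-shift x = trans (lookup-∷ʳ-inject₁ (Vec.map shift f) c x) (Vec.lookup-map x shift f)

    lookup-enclose-end : lookup (enclose c f) end ≡ c
    lookup-enclose-end = lookup-∷ʳ-fromℕ (Vec.map shift f) c

    JoinsEnd : Fin N → Set
    JoinsEnd x = shift (lookup f x) ≡ c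

  -- Block relations on [N+2] extending R on the shifted copy of [N]: S says that 1 and N+2
  -- share a block, L x that x + 1 shares the block of N+2.
  data Enclosed (R : Fin N → Fin N → Set) (S : Set) (L : Fin N → Set) : Fin (2 + N) → Fin (2 + N) → Set where
    start-start : Enclosed R S L start start
    end-end     : Enclosed R S L end end
    shift-shift : ∀ {x y} → R x y → Enclosed R S L (shift x) (shift y)
    start-end   : S → Enclosed R S L start end
    end-start   : S → Enclosed R S L end start
    shift-end   : ∀ {x} → L x → Enclosed R S L (shift x) end
    end-shift   : ∀ {y} → L y → Enclosed R S L end (shift y)

  EndCompatible : (Fin N → Fin N → Set) → (Fin N → Set) → Set
  EndCompatible R L = ∀ a x b → a Fin.< x → x Fin.< b → R a b → L x → R a x

  module _ {R : Fin N → Fin N → Set} {S : Set} {L : Fin N → Set} where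

    Enclosed-noncrossing : Noncrossing R → EndCompatible R L → Noncrossing (Enclosed R S L)
    Enclosed-noncrossing nc joins a c b d a<c c<b b<d start-start   _ = contradiction c<b λ ()
    Enclosed-noncrossing nc joins a c b d a<c c<b b<d end-end       _ = ⊥-elim (end-maximal c a<c)
    Enclosed-noncrossing nc joins a c b d a<c c<b b<d (start-end _) _ = ⊥-elim (end-maximal d b<d)
    Enclosed-noncrossing nc joins a c b d a<c c<b b<d (end-start _) _ = ⊥-elim (end-maximal c a<c)
    Enclosed-noncrossing nc joins a c b d a<c c<b b<d (shift-end _) _ = ⊥-elim (end-maximal d b<d)
    Enclosed-noncrossing nc joins a c b d a<c c<b b<d (end-shift _) _ = ⊥-elim (end-maximal c a<c)
    Enclosed-noncrossing nc joins a c b d a<c c<b b<d (shift-shift _) start-start   = contradiction a<c λ ()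
    Enclosed-noncrossing nc joins a c b d a<c c<b b<d (shift-shift _) (start-end _) = contradiction a<c λ ()
    Enclosed-noncrossing nc joins a c b d a<c c<b b<d (shift-shift _) end-end       = ⊥-elim (end-maximal b c<b)
    Enclosed-noncrossing nc joins a c b d a<c c<b b<d (shift-shift _) (end-start _) = ⊥-elim (end-maximal b c<b)
    Enclosed-noncrossing nc joins a c b d a<c c<b b<d (shift-shift _) (end-shift _) = ⊥-elim (end-maximal b c<b)
    Enclosed-noncrossing nc joins _ _ _ _ a<c c<b b<d (shift-shift {a} {b} Rab) (shift-shift {c} {d} Rcd) =
      shift-shift (nc a c b d (shift-cancel-< a<c) (shift-cancel-< c<b) (shift-cancel-< b<d) Rab Rcd)
    Enclosed-noncrossing nc joins _ _ _ _ a<c c<b b<d (shift-shift {a} {b} Rab) (shift-end {c} Lc) =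
      shift-shift (joins a c b (shift-cancel-< a<c) (shift-cancel-< c<b) Rab Lc)

    Enclosed-start-single : ¬ S → ∀ {y} → Enclosed R S L start y → y ≡ start
    Enclosed-start-single ¬S start-start   = refl
    Enclosed-start-single ¬S (start-end s) = contradiction s ¬S

    Enclosed-end-single : ¬ S → (∀ x → ¬ L x) → ∀ {y} → Enclosed R S L end y → y ≡ end
    Enclosed-end-single ¬S ¬L e = go e refl
      where
      go : ∀ {x y} → Enclosed R S L x y → x ≡ end → y ≡ end
      go end-end         _     = refl
      go (end-start s)   _     = contradiction s ¬S
      go (end-shift l)   _     = contradiction l (¬L _)
      go (shift-shift _) x≡end = contradiction x≡end shift≢end
      go (shift-end _)   x≡end = contradiction x≡end shift≢end

    Enclosed-shift-single : ∀ {i} → (∀ y → R i y → y ≡ i) → ¬ L i →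
                            ∀ {y} → Enclosed R S L (shift i) y → y ≡ shift i
    Enclosed-shift-single {i} single ¬Li e = go e refl
      where
      go : ∀ {x y} → Enclosed R S L x y → x ≡ shift i → y ≡ shift i
      go (shift-shift {x} {y} r) x≡i with shift-injective x≡i
      ... | refl = cong shift (single y r)
      go (shift-end l)           x≡i with shift-injective x≡i
      ... | refl = contradiction l ¬Li
      go end-end                 end≡i = contradiction (sym end≡i) shift≢end
      go (end-start _)           end≡i = contradiction (sym end≡i) shift≢end
      go (end-shift _)           end≡i = contradiction (sym end≡i) shift≢end

  Enclosed-map : {R R′ : Fin N → Fin N → Set} {S S′ : Set} {L : Fin N → Set} →
                 (∀ {x y} → R x y → R′ x y) → (S → S′) →
                 ∀ {x y} → Enclosed R S L x y → Enclosed R′ S′ L x y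
  Enclosed-map r s start-start     = start-start
  Enclosed-map r s end-end         = end-end
  Enclosed-map r s (shift-shift e) = shift-shift (r e)
  Enclosed-map r s (start-end e)   = start-end (s e)
  Enclosed-map r s (end-start e)   = end-start (s e)
  Enclosed-map r s (shift-end e)   = shift-end e
  Enclosed-map r s (end-shift e)   = end-shift e

  module _ {R : Fin N → Fin N → Set} {S : Set} {L : Fin N → Set} where

    Merge-Enclosed : ∀ {i j x y} → Merge (Enclosed R S L) (shift i) (shift j) x y ⇔ Enclosed (Merge R i j) S L x y
    Merge-Enclosed = mk⇔ to′ from′
      where
      to′ : ∀ {i j x y} → Merge (Enclosed R S L) (shift i) (shift j) x y → Enclosed (Merge R i j) S L x y
      to′ (inj₁ e)                   = Enclosed-map inj₁ (λ s → s) e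
      to′ (inj₂ (inj₁ (refl , refl))) = shift-shift (inj₂ (inj₁ (refl , refl)))
      to′ (inj₂ (inj₂ (refl , refl))) = shift-shift (inj₂ (inj₂ (refl , refl)))

      from′ : ∀ {i j x y} → Enclosed (Merge R i j) S L x y → Merge (Enclosed R S L) (shift i) (shift j) x y
      from′ start-start                             = inj₁ start-start
      from′ end-end                                 = inj₁ end-end
      from′ (shift-shift (inj₁ r))                  = inj₁ (shift-shift r)
      from′ (shift-shift (inj₂ (inj₁ (refl , refl)))) = inj₂ (inj₁ (refl , refl))
      from′ (shift-shift (inj₂ (inj₂ (refl , refl)))) = inj₂ (inj₂ (refl , refl))
      from′ (start-end s)                           = inj₁ (start-end s)
      from′ (end-start s)                           = inj₁ (end-start s)
      from′ (shift-end l)                           = inj₁ (shift-end l)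
      from′ (end-shift l)                           = inj₁ (end-shift l)

    Merge-Enclosed-ends : ∀ {x y} → Merge (Enclosed R S L) start end x y ⇔ Enclosed R ⊤ L x y
    Merge-Enclosed-ends = mk⇔ to′ from′
      where
      to′ : ∀ {x y} → Merge (Enclosed R S L) start end x y → Enclosed R ⊤ L x y
      to′ (inj₁ e)                   = Enclosed-map (λ r → r) _ e
      to′ (inj₂ (inj₁ (refl , refl))) = start-end _
      to′ (inj₂ (inj₂ (refl , refl))) = end-start _

      from′ : ∀ {x y} → Enclosed R ⊤ L x y → Merge (Enclosed R S L) start end x y
      from′ start-start     = inj₁ start-start
      from′ end-end         = inj₁ end-end
      from′ (shift-shift r) = inj₁ (shift-shift r)
      from′ (start-end _)   = inj₂ (inj₁ (refl , refl))
      from′ (end-start _)   = inj₂ (inj₂ (refl , refl))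
      from′ (shift-end l)   = inj₁ (shift-end l)
      from′ (end-shift l)   = inj₁ (end-shift l)

  module _ (c : Fin (2 + N)) (f : Vec (Fin N) N) where

    private
      g : Fin (2 + N) → Fin (2 + N)
      g = lookup (enclose c f)

      g-shift : (x : Fin N) → g (shift x) ≡ shift (lookup f x)
      g-shift = lookup-enclose-shift c f

      g-end : g end ≡ c
      g-end = lookup-enclose-end c f

    SameBlock-enclose : ∀ {x y} → SameBlock (enclose c f) x y ⇔
                        Enclosed (SameBlock f) (start ≡ c) (JoinsEnd c f) x y
    SameBlock-enclose = mk⇔ to′ from′
      where
      to′ : ∀ {x y} → g x ≡ g y → Enclosed (SameBlock f) (start ≡ c) (JoinsEnd c f) x y
      to′ {x} {y} e with position x | position y
      ... | is-start   | is-start   = start-start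
      ... | is-start   | is-shift v with () ← trans e (g-shift v)
      ... | is-start   | is-end     = start-end (trans e g-end)
      ... | is-shift u | is-start   with () ← trans (sym (g-shift u)) e
      ... | is-shift u | is-shift v = shift-shift (shift-injective (trans (sym (g-shift u)) (trans e (g-shift v))))
      ... | is-shift u | is-end     = shift-end (trans (sym (g-shift u)) (trans e g-end))
      ... | is-end     | is-start   = end-start (trans (sym e) g-end)
      ... | is-end     | is-shift v = end-shift (trans (sym (g-shift v)) (trans (sym e) g-end))
      ... | is-end     | is-end     = end-end

      from′ : ∀ {x y} → Enclosed (SameBlock f) (start ≡ c) (JoinsEnd c f) x y → g x ≡ g y
      from′ start-start                 = refl
      from′ end-end                     = refl
      from′ (shift-shift {u} {v} same)  = trans (g-shift u) (trans (cong shift same) (sym (g-shift v)))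
      from′ (start-end s)               = trans s (sym g-end)
      from′ (end-start s)               = trans g-end (sym s)
      from′ (shift-end {u} l)           = trans (g-shift u) (trans l (sym g-end))
      from′ (end-shift {v} l)           = trans g-end (trans (sym l) (sym (g-shift v)))

    Noncrossing-enclose : Noncrossing (Enclosed (SameBlock f) (start ≡ c) (JoinsEnd c f)) →
                          Noncrossing (SameBlock (enclose c f))
    Noncrossing-enclose = from (Noncrossing-cong (λ {x y} → SameBlock-enclose {x} {y}))

    Noncrossing-Merge-enclose : ∀ {i j} →
                                Noncrossing (Enclosed (Merge (SameBlock f) i j) (start ≡ c) (JoinsEnd c f)) →
                                Noncrossing (Merge (SameBlock (enclose c f)) (shift i) (shift j))
    Noncrossing-Merge-enclose =
      from (Noncrossing-cong (λ {x y} →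
        Merge-Enclosed ⇔-∘ Merge-cong (λ {x y} → SameBlock-enclose {x} {y}) {x} {y}))

    Noncrossing-Merge-ends-enclose : Noncrossing (Enclosed (SameBlock f) ⊤ (JoinsEnd c f)) →
                                     Noncrossing (Merge (SameBlock (enclose c f)) start end)
    Noncrossing-Merge-ends-enclose =
      from (Noncrossing-cong (λ {x y} →
        Merge-Enclosed-ends ⇔-∘ Merge-cong (λ {x y} → SameBlock-enclose {x} {y}) {x} {y}))

    IsPartition-enclose : IsPartition f → g c ≡ c → IsPartition (enclose c f)
    IsPartition-enclose part gc≡c x with position x
    ... | is-start   = z≤n , refl
    ... | is-end     = subst (Fin._≤ end) (sym g-end) (Fin.≤fromℕ c) , trans (cong g g-end) (trans gc≡c (sym g-end))
    ... | is-shift u = let fu≤u , ffu≡fu = part u in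
      subst (Fin._≤ shift u) (sym (g-shift u)) (shift-mono-≤ fu≤u) ,
      (begin
        g (g (shift u))               ≡⟨ cong g (g-shift u) ⟩
        g (shift (lookup f u))        ≡⟨ g-shift (lookup f u) ⟩
        shift (lookup f (lookup f u)) ≡⟨ cong shift ffu≡fu ⟩
        shift (lookup f u)            ≡⟨ g-shift u ⟨
        g (shift u)                   ∎)

  module _ {c : Fin (2 + N)} {f : Vec (Fin N) N} where

    NoncrossingPartition-enclose : NoncrossingPartition f → lookup (enclose c f) c ≡ c →
                                   EndCompatible (SameBlock f) (JoinsEnd c f) → NoncrossingPartition (enclose c f)
    NoncrossingPartition-enclose (part , nc) gc≡c compatible =
      IsPartition-enclose c f part gc≡c ,
      Noncrossing-enclose c f (Enclosed-noncrossing nc compatible)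

    Marriage-enclose : (m : Marriage f) → let open Marriage m in
                       ¬ JoinsEnd c f i → ¬ JoinsEnd c f j →
                       EndCompatible (Merge (SameBlock f) i j) (JoinsEnd c f) → Marriage (enclose c f)
    Marriage-enclose (marriage i j i≢j i-single j-single nc) i↛end j↛end compatible =
      marriage (shift i) (shift j) (i≢j ∘ shift-injective)
        (λ _ → Enclosed-shift-single i-single i↛end ∘ to (SameBlock-enclose c f))
        (λ _ → Enclosed-shift-single j-single j↛end ∘ to (SameBlock-enclose c f))
        (Noncrossing-Merge-enclose c f (Enclosed-noncrossing nc compatible))

  enclose-injective : {c c′ : Fin (2 + N)} {f f′ : Vec (Fin N) N} →
                      enclose c f ≡ enclose c′ f′ → c ≡ c′ × f ≡ f′
  enclose-injective {f = f} {f′} e =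
    let mf≡mf′ , c≡c′ = Vec.∷ʳ-injective (Vec.map shift f) (Vec.map shift f′) (Vec.∷-injectiveʳ e) in
    c≡c′ , map-injective shift-injective mf≡mf′

  module _ {f : Vec (Fin N) N} where

    nothing-joins-end : ∀ {Q} → EndCompatible Q (JoinsEnd end f)
    nothing-joins-end _ _ _ _ _ _ = ⊥-elim ∘ shift≢end

    enclose-end-marriageable : NoncrossingPartition f → Marriageable (enclose end f)
    enclose-end-marriageable (part , nc) =
      NoncrossingPartition-enclose (part , nc) (lookup-enclose-end end f) nothing-joins-end ,
      marriage start end (λ ())
        (λ _ → Enclosed-start-single (λ ()) ∘ to (SameBlock-enclose end f))
        (λ _ → Enclosed-end-single (λ ()) (λ _ → shift≢end) ∘ to (SameBlock-enclose end f))
        (Noncrossing-Merge-ends-enclose end f (Enclosed-noncrossing nc nothing-joins-end))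

    enclose-start-marriageable : Marriageable f → Marriageable (enclose start f)
    enclose-start-marriageable (ncp , m) =
      NoncrossingPartition-enclose ncp refl (λ _ _ _ _ _ _ ()) ,
      Marriage-enclose m (λ ()) (λ ()) (λ _ _ _ _ _ _ ())

module Prepend {N : ℕ} where

  lift : Fin N → Fin (2 + N)
  lift = 2 Fin.↑ʳ_

  prepend : Vec (Fin N) N → Vec (Fin (2 + N)) (2 + N)
  prepend f = zero ∷ zero ∷ Vec.map lift f

  data Prefixed (R : Fin N → Fin N → Set) : Fin (2 + N) → Fin (2 + N) → Set where
    pair   : ∀ {x y} → toℕ x ℕ.< 2 → toℕ y ℕ.< 2 → Prefixed R x y
    lifted : ∀ {x y} → R x y → Prefixed R (lift x) (lift y)

  Prefixed-noncrossing : {R : Fin N → Fin N → Set} → Noncrossing R → Noncrossing (Prefixed R)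
  Prefixed-noncrossing nc a c b d a<c c<b b<d (pair _ b<2) _ =
    ⊥-elim (ℕ.<⇒≱ b<2 (ℕ.≤-trans (s≤s (ℕ.≤-trans (s≤s z≤n) a<c)) c<b))
  Prefixed-noncrossing nc _ c b d a<c c<b b<d (lifted _) (pair c<2 _) =
    ⊥-elim (ℕ.<⇒≱ c<2 (ℕ.≤-trans (s≤s (s≤s z≤n)) a<c))
  Prefixed-noncrossing nc _ _ _ _ a<c c<b b<d (lifted {a} {b} Rab) (lifted {c} {d} Rcd) =
    lifted (nc a c b d (unlift a<c) (unlift c<b) (unlift b<d) Rab Rcd)
    where
    unlift : ∀ {x y} → lift x Fin.< lift y → x Fin.< y
    unlift = ℕ.s<s⁻¹ ∘ ℕ.s<s⁻¹

  Prefixed-map : {R R′ : Fin N → Fin N → Set} → (∀ {x y} → R x y → R′ x y) →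
                 ∀ {x y} → Prefixed R x y → Prefixed R′ x y
  Prefixed-map r (pair px py) = pair px py
  Prefixed-map r (lifted e)   = lifted (r e)

  Prefixed-lifted-single : {R : Fin N → Fin N → Set} {i : Fin N} → (∀ y → R i y → y ≡ i) →
                           ∀ {y} → Prefixed R (lift i) y → y ≡ lift i
  Prefixed-lifted-single single (lifted {y = y} r)      = cong lift (single y r)
  Prefixed-lifted-single single (pair (s≤s (s≤s ())) _)

  Merge-Prefixed : {R : Fin N → Fin N → Set} {i j : Fin N} →
                   ∀ {x y} → Merge (Prefixed R) (lift i) (lift j) x y ⇔ Prefixed (Merge R i j) x y
  Merge-Prefixed = mk⇔ to′ from′
    where
    to′ : ∀ {R i j x y} → Merge (Prefixed R) (lift i) (lift j) x y → Prefixed (Merge R i j) x y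
    to′ (inj₁ e)                    = Prefixed-map inj₁ e
    to′ (inj₂ (inj₁ (refl , refl))) = lifted (inj₂ (inj₁ (refl , refl)))
    to′ (inj₂ (inj₂ (refl , refl))) = lifted (inj₂ (inj₂ (refl , refl)))

    from′ : ∀ {R i j x y} → Prefixed (Merge R i j) x y → Merge (Prefixed R) (lift i) (lift j) x y
    from′ (pair px py)                          = inj₁ (pair px py)
    from′ (lifted (inj₁ r))                     = inj₁ (lifted r)
    from′ (lifted (inj₂ (inj₁ (refl , refl)))) = inj₂ (inj₁ (refl , refl))
    from′ (lifted (inj₂ (inj₂ (refl , refl)))) = inj₂ (inj₂ (refl , refl))

  module _ (f : Vec (Fin N) N) where

    private
      g : Fin (2 + N) → Fin (2 + N)
      g = lookup (prepend f)

      g-lift : (x : Fin N) → g (lift x) ≡ lift (lookup f x)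
      g-lift x = Vec.lookup-map x lift f

      g-pair : ∀ {x} → toℕ x ℕ.< 2 → g x ≡ zero
      g-pair {zero}        _ = refl
      g-pair {suc zero}    _ = refl
      g-pair {suc (suc x)} (s≤s (s≤s ()))

    SameBlock-prepend : ∀ {x y} → SameBlock (prepend f) x y ⇔ Prefixed (SameBlock f) x y
    SameBlock-prepend = mk⇔ to′ from′
      where
      to′ : ∀ {x y} → g x ≡ g y → Prefixed (SameBlock f) x y
      to′ {suc (suc u)} {suc (suc v)} e = lifted (Fin.↑ʳ-injective 2 _ _ (trans (sym (g-lift u)) (trans e (g-lift v))))
      to′ {zero}        {zero}        _ = pair (s≤s z≤n) (s≤s z≤n)
      to′ {zero}        {suc zero}    _ = pair (s≤s z≤n) (s≤s (s≤s z≤n))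
      to′ {suc zero}    {zero}        _ = pair (s≤s (s≤s z≤n)) (s≤s z≤n)
      to′ {suc zero}    {suc zero}    _ = pair (s≤s (s≤s z≤n)) (s≤s (s≤s z≤n))
      to′ {zero}        {suc (suc v)} e with () ← trans e (g-lift v)
      to′ {suc zero}    {suc (suc v)} e with () ← trans e (g-lift v)
      to′ {suc (suc u)} {zero}        e with () ← trans (sym e) (g-lift u)
      to′ {suc (suc u)} {suc zero}    e with () ← trans (sym e) (g-lift u)

      from′ : ∀ {x y} → Prefixed (SameBlock f) x y → g x ≡ g y
      from′ (pair px py)              = trans (g-pair px) (sym (g-pair py))
      from′ (lifted {u} {v} same)     = trans (g-lift u) (trans (cong lift same) (sym (g-lift v)))

    Noncrossing-prepend : Noncrossing (Prefixed (SameBlock f)) → Noncrossing (SameBlock (prepend f))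
    Noncrossing-prepend = from (Noncrossing-cong (λ {x y} → SameBlock-prepend {x} {y}))

    Noncrossing-Merge-prepend : ∀ {i j} → Noncrossing (Prefixed (Merge (SameBlock f) i j)) →
                                Noncrossing (Merge (SameBlock (prepend f)) (lift i) (lift j))
    Noncrossing-Merge-prepend =
      from (Noncrossing-cong (λ {x y} →
        Merge-Prefixed ⇔-∘ Merge-cong (λ {x y} → SameBlock-prepend {x} {y}) {x} {y}))

    IsPartition-prepend : IsPartition f → IsPartition (prepend f)
    IsPartition-prepend part zero          = z≤n , refl
    IsPartition-prepend part (suc zero)    = z≤n , refl
    IsPartition-prepend part (suc (suc u)) = let fu≤u , ffu≡fu = part u in
      subst (Fin._≤ lift u) (sym (g-lift u)) (s≤s (s≤s fu≤u)) ,
      (begin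
        g (g (lift u))               ≡⟨ cong g (g-lift u) ⟩
        g (lift (lookup f u))        ≡⟨ g-lift (lookup f u) ⟩
        lift (lookup f (lookup f u)) ≡⟨ cong lift ffu≡fu ⟩
        lift (lookup f u)            ≡⟨ g-lift u ⟨
        g (lift u)                   ∎)

  prepend-injective : {f f′ : Vec (Fin N) N} → prepend f ≡ prepend f′ → f ≡ f′
  prepend-injective = map-injective (Fin.↑ʳ-injective 2 _ _) ∘ Vec.∷-injectiveʳ ∘ Vec.∷-injectiveʳ

  prepend-marriageable : {f : Vec (Fin N) N} → Marriageable f → Marriageable (prepend f)
  prepend-marriageable {f} ((part , nc) , marriage i j i≢j i-single j-single nc-merge) =
    (IsPartition-prepend f part , Noncrossing-prepend f (Prefixed-noncrossing nc)) ,
    marriage (lift i) (lift j) (i≢j ∘ Fin.↑ʳ-injective 2 i j)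
      (λ _ → Prefixed-lifted-single i-single ∘ to (SameBlock-prepend f))
      (λ _ → Prefixed-lifted-single j-single ∘ to (SameBlock-prepend f))
      (Noncrossing-Merge-prepend f (Prefixed-noncrossing nc-merge))

extendLast : {k : ℕ} → Vec (Fin (suc k)) (suc k) → Vec (Fin (3 + k)) (3 + k)
extendLast {k} f = Enclose.enclose (Enclose.shift (lookup f (fromℕ k))) f

module _ {k : ℕ} {f : Vec (Fin (suc k)) (suc k)} where
  open Enclose

  private
    top : Fin (suc k)
    top = fromℕ k

    c : Fin (3 + k)
    c = shift (lookup f top)

  below-≢top : {x y : Fin (suc k)} → x Fin.< y → x ≢ top
  below-≢top {y = y} x<y refl = ℕ.<⇒≱ x<y (Fin.≤fromℕ y)

  ≢top⇒<top : {x : Fin (suc k)} → x ≢ top → x Fin.< top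
  ≢top⇒<top {x} = Fin.≤∧≢⇒< (Fin.≤fromℕ x)

  top-compatible : {Q : Fin (suc k) → Fin (suc k) → Set} → Noncrossing Q →
                   (∀ {x y} → SameBlock f x y → Q x y) → (∀ {x} → Q x top → SameBlock f x top) →
                   EndCompatible Q (JoinsEnd c f)
  top-compatible nc embed restrict a x b a<x x<b Qab fx≡ftop with b ≟ top
  ... | yes refl  = embed (trans (restrict Qab) (sym (shift-injective fx≡ftop)))
  ... | no b≢top  = nc a x b top a<x x<b (≢top⇒<top b≢top) Qab (embed (shift-injective fx≡ftop))

  marriage-start : (o : Fin (suc k)) → o ≢ top → IsSingleton f o → IsSingleton f top →
                   Noncrossing (Merge (SameBlock f) o top) → Noncrossing (SameBlock (enclose c f)) →
                   Marriage (enclose c f)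
  marriage-start o o≢top o-single top-single nc-merge nc =
    marriage start (shift o) (λ ())
      (λ _ → Enclosed-start-single (λ ()) ∘ to (SameBlock-enclose c f))
      (λ _ → Enclosed-shift-single o-single (o≢top ∘ sym ∘ o-single top ∘ shift-injective)
               ∘ to (SameBlock-enclose c f))
      (Noncrossing-Merge sym nc (s≤s z≤n) (λ s<x x<o → stays s<x x<o ∘ to (SameBlock-enclose c f)))
    where
    confined : ∀ {x y} → x Fin.< o → SameBlock f x y → y Fin.< o
    confined {x} {y} x<o x~y with Fin.<-cmp y o
    ... | tri< y<o _ _ = y<o
    ... | tri≈ _ refl _ = ⊥-elim (Fin.<⇒≢ x<o (o-single x (sym x~y)))
    ... | tri> _ _ o<y with y ≟ top
    ...   | yes refl  = ⊥-elim (below-≢top x<o (top-single x (sym x~y)))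
    ...   | no y≢top with nc-merge x o y top x<o o<y (≢top⇒<top y≢top) (inj₁ x~y) (inj₂ (inj₁ (refl , refl)))
    ...     | inj₁ x~o              = ⊥-elim (Fin.<⇒≢ x<o (o-single x (sym x~o)))
    ...     | inj₂ (inj₁ (x≡o , _))   = ⊥-elim (Fin.<⇒≢ x<o x≡o)
    ...     | inj₂ (inj₂ (x≡top , _)) = ⊥-elim (below-≢top x<o x≡top)

    stays : ∀ {x y} → start {N = suc k} Fin.< x → x Fin.< shift o →
            Enclosed (SameBlock f) (start ≡ c) (JoinsEnd c f) x y → start {N = suc k} Fin.< y × y Fin.< shift o
    stays _   x<o (shift-shift x~y) = s≤s z≤n , shift-mono-< (confined (shift-cancel-< x<o) x~y)
    stays _   x<o (shift-end {x} l) =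
      ⊥-elim (below-≢top (shift-cancel-< x<o) (top-single x (sym (shift-injective l))))
    stays _   x<o end-end           = ⊥-elim (end-maximal (shift o) x<o)
    stays _   x<o (end-start _)     = ⊥-elim (end-maximal (shift o) x<o)
    stays _   x<o (end-shift _)     = ⊥-elim (end-maximal (shift o) x<o)

  extendLast-marriageable : Marriageable f → Marriageable (extendLast f)
  extendLast-marriageable ((part , nc) , m@(marriage i j i≢j i-single j-single nc-merge)) = ncp , married
    where
    ncp : NoncrossingPartition (enclose c f)
    ncp = NoncrossingPartition-enclose (part , nc)
            (trans (lookup-enclose-shift c f (lookup f top)) (cong shift (proj₂ (part top))))
            (top-compatible nc (λ s → s) (λ s → s))

    apart-from-top : ∀ {x} → IsSingleton f x → x ≢ top → ¬ JoinsEnd c f x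
    apart-from-top x-single x≢top e = x≢top (sym (x-single top (shift-injective e)))

    married : Marriage (enclose c f)
    married with i ≟ top | j ≟ top
    ... | yes refl | _        = marriage-start j (i≢j ∘ sym) j-single i-single
                                  (from (Noncrossing-cong (Merge-comm {R = SameBlock f})) nc-merge) (proj₂ ncp)
    ... | no _     | yes refl = marriage-start i i≢j i-single j-single nc-merge (proj₂ ncp)
    ... | no i≢top | no j≢top = Marriage-enclose m (apart-from-top i-single i≢top) (apart-from-top j-single j≢top)
                                  (top-compatible nc-merge inj₁ restrict)
      where
      restrict : ∀ {x} → Merge (SameBlock f) i j x top → SameBlock f x top
      restrict (inj₁ x~top)            = x~top
      restrict (inj₂ (inj₁ (_ , top≡j))) = ⊥-elim (j≢top (sym top≡j))
      restrict (inj₂ (inj₂ (_ , top≡i))) = ⊥-elim (i≢top (sym top≡i))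

Disjoint-map : {A B : Set} {g h : A → B} {xs ys : List A} →
               (∀ u w → g u ≢ h w) → Disjoint (map g xs) (map h ys)
Disjoint-map {g = g} {h} g≢h (v∈gxs , v∈hys) with ∈-map⁻ g v∈gxs | ∈-map⁻ h v∈hys
... | u , _ , refl | w , _ , gu≡hw = g≢h u w gu≡hw

length-concat : {A : Set} (xss : List (List A)) → length (concat xss) ≡ sum (map length xss)
length-concat []         = refl
length-concat (xs ∷ xss) = trans (length-++ xs) (cong (length xs +_) (length-concat xss))

enclose≢prepend : {k : ℕ} {c : Fin (3 + k)} {f f′ : Vec (Fin (suc k)) (suc k)} →
                  Enclose.enclose c f ≢ Prepend.prepend f′
enclose≢prepend {f = x ∷ f} e with () ← Vec.∷-injectiveˡ (Vec.∷-injectiveʳ e)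

module _ (k : ℕ) where
  open Enclose
  open Prepend

  private
    N : ℕ
    N = suc k

    candidates : (Vec (Fin N) N → Bool) → List (Vec (Fin N) N)
    candidates p = filterᵇ p (allVecs N N)

  images : List (List (Vec (Fin (2 + N)) (2 + N)))
  images = map (enclose end)   (candidates isNoncrossing)
         ∷ map (enclose start) (candidates isMarriageable)
         ∷ map prepend         (candidates isMarriageable)
         ∷ map extendLast      (candidates isMarriageable)
         ∷ []

  images-length : sum (map length images) ≡ C N + 3 * M N
  images-length rewrite length-map (enclose end)   (candidates isNoncrossing)
                      | length-map (enclose start) (candidates isMarriageable)
                      | length-map prepend         (candidates isMarriageable)
                      | length-map extendLast      (candidates isMarriageable)
                      | count≡length-filterᵇ isNoncrossing  (allVecs N N)
                      | count≡length-filterᵇ isMarriageable (allVecs N N) = refl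

  images-marriageable : All (All (T ∘ isMarriageable)) images
  images-marriageable =
      image (λ f → from T-isMarriageable ∘ enclose-end-marriageable {f = f} ∘ to (T-isNoncrossing {f = f}))
    ∷ image (λ f → from T-isMarriageable ∘ enclose-start-marriageable {f = f} ∘ to T-isMarriageable)
    ∷ image (λ f → from T-isMarriageable ∘ prepend-marriageable {f = f} ∘ to T-isMarriageable)
    ∷ image (λ f → from T-isMarriageable ∘ extendLast-marriageable {f = f} ∘ to T-isMarriageable)
    ∷ []
    where
    image : {p : Vec (Fin N) N → Bool} {g : Vec (Fin N) N → Vec (Fin (2 + N)) (2 + N)} →
            (∀ f → T (p f) → T (isMarriageable (g f))) → All (T ∘ isMarriageable) (map g (candidates p))
    image {p} ok = All.map⁺ (All.map (ok _) (All.all-filter (T? ∘ p) (allVecs N N)))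

  images-unique : Unique (concat images)
  images-unique = Unique.concat⁺
    (image (proj₂ ∘ enclose-injective) ∷ image (proj₂ ∘ enclose-injective) ∷ image prepend-injective ∷
     image (proj₂ ∘ enclose-injective) ∷ [])
    disjoint
    where
    image : {p : Vec (Fin N) N → Bool} {g : Vec (Fin N) N → Vec (Fin (2 + N)) (2 + N)} →
            (∀ {f f′} → g f ≡ g f′ → f ≡ f′) → Unique (map g (candidates p))
    image {p} g-inj = Unique.map⁺ g-inj (Unique.filter⁺ (T? ∘ p) (allVecs-unique N N))

    apart : {c c′ : Vec (Fin N) N → Fin (2 + N)} {xs ys : List (Vec (Fin N) N)} →
            (∀ {f f′} → c f ≢ c′ f′) →
            Disjoint (map (λ f → enclose (c f) f) xs) (map (λ f → enclose (c′ f) f) ys)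
    apart c≢c′ = Disjoint-map (λ _ _ → c≢c′ ∘ proj₁ ∘ enclose-injective)

    disjoint : AllPairs Disjoint images
    disjoint = (apart (λ ()) ∷ Disjoint-map (λ _ _ → enclose≢prepend) ∷ apart (shift≢end ∘ sym) ∷ [])
             ∷ (Disjoint-map (λ _ _ → enclose≢prepend) ∷ apart (λ ()) ∷ [])
             ∷ (Disjoint-map (λ _ _ → enclose≢prepend ∘ sym) ∷ [])
             ∷ [] ∷ []

C+3M≤M : (k : ℕ) → C (suc k) + 3 * M (suc k) ≤ M (3 + k)
C+3M≤M k = subst (_≤ M (3 + k)) (trans (length-concat (images k)) (images-length k))
  (Unique-⊆⇒length≤count isMarriageable (images-unique k) (λ {v} _ → ∈-allVecs v)
                                         (All.concat⁺ (images-marriageable k)))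

proposition22 : (n : ℕ) → C n + 3 * M n ≤ M (n + 2)
proposition22 zero    = s≤s z≤n
proposition22 (suc k) = subst (λ m → C (suc k) + 3 * M (suc k) ≤ M m) (ℕ.+-comm 2 (suc k)) (C+3M≤M k)
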